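{- Let $r\ge 3$ and let $G$ be a graph on $n$ vertices with $\Delta(G)\le r$ such that for every $t\ge3$, \[ k_t(G)\le\frac{r-t+1}{t}\,k_{t-1}(G). \] If $n=a(r+1)+b$ with integers $a\ge1$ and $0\le b\le r$, then \[ k(G)<k(aK_{r+1}\cup K_b). \]
   Context: Graphs are finite and simple. A clique is a set of pairwise adjacent vertices; $k_t(G)$ is the number of cliques of size $t$ in $G$ and $k(G)=\sum_{t\ge0}k_t(G)$ (the empty clique included). $aK_{r+1}\cup K_b$ is the disjoint union of $a$ copies of $K_{r+1}$ and one copy of $K_b$ ($K_0$ being the empty graph). -}

module Defs where

open import Data.Nat using (ℕ; zero; suc; _+_; _*_; _/_; _≡ᵇ_)
open import Data.Bool using (Bool; true; false; _∧_; _∨_; not; if_then_else_)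
open import Data.Fin using (Fin; toℕ; _≟_)
open import Data.Fin.Subset using (Subset; ∣_∣)
open import Data.Vec using (Vec; []; _∷_; lookup)
open import Data.List using (List; []; _∷_; map; _++_; allFin; upTo)
open import Data.Bool.ListAction using (all)
open import Data.Nat.ListAction using (sum)
open import Relation.Nullary.Decidable using (isYes)
open import Relation.Binary.PropositionalEquality using (_≡_; refl; cong₂) renaming (sym to ≡-sym)
open import Relation.Nullary using (yes; no)

record Graph (n : ℕ) : Set where
  field
    adj    : Fin n → Fin n → Bool
    sym    : ∀ i j → adj i j ≡ adj j i
    irrefl : ∀ i → adj i i ≡ false
open Graph public

degree : ∀ {n} → Graph n → Fin n → ℕ
degree {n} G v = sum (map (λ u → if adj G v u then 1 else 0) (allFin n))

MaxDegree≤ : ∀ {n} → Graph n → ℕ → Set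
MaxDegree≤ {n} G r = ∀ v → degree G v Data.Nat.≤ r

allSubsets : ∀ n → List (Subset n)
allSubsets zero    = [] ∷ []
allSubsets (suc n) = map (true ∷_) (allSubsets n) ++ map (false ∷_) (allSubsets n)

isClique : ∀ {n} → Graph n → Subset n → Bool
isClique {n} G S =
  all (λ i → all (λ j → not (lookup S i ∧ lookup S j) ∨ isYes (i ≟ j) ∨ adj G i j)
                 (allFin n))
      (allFin n)

-- k_t(G): number of cliques of size t (the empty set counts for t = 0)
k_ : ∀ {n} → Graph n → ℕ → ℕ
k_ {n} G t = sum (map (λ S → if (∣ S ∣ ≡ᵇ t) ∧ isClique G S then 1 else 0) (allSubsets n))

-- k(G) = Σ_{t ≥ 0} k_t(G); cliques have size ≤ n, so summing t = 0..n suffices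
kTotal : ∀ {n} → Graph n → ℕ
kTotal {n} G = sum (map (k_ G) (upTo (suc n)))

-- a K_{r+1} ∪ K_b on the vertex set Fin (a(r+1)+b), 0 ≤ b ≤ r:
-- vertices i ≠ j are adjacent iff ⌊i/(r+1)⌋ = ⌊j/(r+1)⌋, i.e. blocks
-- {0..r}, {r+1..2r+1}, …, a full blocks of size r+1 and a last block of size b.
blockAdj : (r m : ℕ) → Fin m → Fin m → Bool
blockAdj r m i j = not (isYes (i ≟ j)) ∧ ((toℕ i / suc r) ≡ᵇ (toℕ j / suc r))

private
  ≡ᵇ-sym : ∀ m n → (m ≡ᵇ n) ≡ (n ≡ᵇ m)
  ≡ᵇ-sym zero zero = refl
  ≡ᵇ-sym zero (suc n) = refl
  ≡ᵇ-sym (suc m) zero = refl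
  ≡ᵇ-sym (suc m) (suc n) = ≡ᵇ-sym m n

  ≟-sym : ∀ {m} (i j : Fin m) → isYes (i ≟ j) ≡ isYes (j ≟ i)
  ≟-sym i j with i ≟ j | j ≟ i
  ... | yes _ | yes _ = refl
  ... | no _  | no _  = refl
  ... | yes p | no q  = Data.Empty.⊥-elim (q (≡-sym p))
    where import Data.Empty
  ... | no p  | yes q = Data.Empty.⊥-elim (p (≡-sym q))
    where import Data.Empty

  isYes-diag : ∀ {m} (i : Fin m) → isYes (i ≟ i) ≡ true
  isYes-diag i with i ≟ i
  ... | yes _ = refl
  ... | no p  = Data.Empty.⊥-elim (p refl)
    where import Data.Empty

blockGraph : (a r b : ℕ) → Graph (a * suc r + b)
blockGraph a r b = record
  { adj    = blockAdj r m
  ; sym    = λ i j → cong₂ (λ x y → not x ∧ y) (≟-sym i j) (≡ᵇ-sym (toℕ i / suc r) (toℕ j / suc r))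
  ; irrefl = λ i → cong₂ (λ x y → not x ∧ y) (isYes-diag i) refl
  }
  where m = a * suc r + b

-- Write s = r - 1. Counting edges at each vertex gives 2 k₂ ≤ n r, and comparing the ratio
-- condition (t + 1) k_{t+1} ≤ (r - t) k_t with (t + 1) C(r, t + 1) = (r - t) C(r, t) gives
-- s k_t ≤ n C(r, t) for all t ≥ 2. Summing, with k₀ ≤ 1 and k₁ ≤ n,
--   s k(G) ≤ s (1 + n) + n (2^r - 1 - r).
-- In a K_{r+1} ∪ K_b every subset of a block is a clique, so it has a 2^{r+1} + 2^b - a cliques,
-- and for n = a (r + 1) + b the bound above is smaller than s times this number, except when
-- r = 3, a = 1, b = 2, where both give 19. There k₄ = k₅ = k₆ = 0 and 3 k₃ ≤ k₂ ≤ 9, so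
-- k(G) ≤ 18 unless k₂ = 9, that is, unless G is cubic; the cubic graphs on six vertices have at
-- most two triangles, which is verified by exhaustive search.

module Submission where

open import Defs
open import Data.Bool using (Bool; true; false; _∧_; _∨_; not; if_then_else_)
open import Data.Bool.Properties using (T-≡; ∧-conicalˡ; ∧-assoc; ∧-idem; ∧-zeroʳ; ∧-identityʳ)
open import Data.Bool.ListAction using (all; and)
open import Data.Fin using (Fin; zero; suc; toℕ; _≟_)
open import Data.Fin.Subset using (Subset; ∣_∣; ⊥)
open import Data.Fin.Subset.Properties using (∣p∣≤n)
open import Data.Integer using (+_; _-_; _⊖_) renaming (_*_ to _*ℤ_; _≤_ to _≤ℤ_)
import Data.Integer.Properties as ℤ
open import Data.Integer.Properties
  using (drop‿+≤+; [+m]-[+n]≡m⊖n; [1+m]⊖[1+n]≡m⊖n; ⊖-≥; ⊖-<; neg-≤-pos; pos-*; *-monoʳ-≤-nonNeg)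
open import Data.List using (map; _++_; allFin; applyUpTo; tabulate)
open import Data.List.Properties using (map-++; map-∘; map-tabulate)
import Data.Nat as ℕ
open import Data.Nat using (ℕ; zero; suc; _+_; _*_; _∸_; _^_; _≤_; _<_; z≤n; s≤s; _≡ᵇ_; _<ᵇ_; _≤ᵇ_; _/_)
open import Data.Nat.Combinatorics using (_C_; nC1≡n; nCk+nC[k+1]≡[n+1]C[k+1]; k>n⇒nCk≡0)
open import Data.Nat.DivMod using (+-distrib-/-∣ˡ; m*n/n≡m; m<n⇒m/n≡0)
open import Data.Nat.Divisibility using (n∣m*n)
open import Data.Nat.ListAction using (sum)
open import Data.Nat.ListAction.Properties using (sum-++)
open import Data.Nat.Properties hiding (_≟_)
open import Data.Nat.Tactic.RingSolver using (solve-∀)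
open import Algebra.Properties.CommutativeSemigroup +-commutativeSemigroup
  using () renaming (interchange to +-interchange)
open import Algebra.Properties.CommutativeSemigroup *-commutativeSemigroup
  using () renaming (x∙yz≈y∙xz to x*[y*z]≡y*[x*z])
open import Data.Product using (_×_; _,_)
open import Data.Sum using (_⊎_; inj₁; inj₂)
open import Data.Unit using (⊤; tt)
import Data.Vec as Vec
open import Data.Vec using (Vec; []; _∷_; lookup)
open import Data.Vec.Properties using (lookup-replicate; lookup∘tabulate)
open import Function using (_∘_; Equivalence)
open import Relation.Binary.PropositionalEquality
  using (_≡_; refl; cong; cong₂; trans; subst; subst₂; module ≡-Reasoning) renaming (sym to ≡-sym)
open import Relation.Nullary using (¬_; yes; no; contradiction)
open import Relation.Nullary.Decidable using (isYes; isYes≗does; dec-true; _×-dec_)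

-- Finite sums

ind : Bool → ℕ
ind b = if b then 1 else 0

ind-mono : ∀ {b c} → (b ≡ true → c ≡ true) → ind b ≤ ind c
ind-mono {false} _ = z≤n
ind-mono {true}  h rewrite h refl = ≤-refl

sumF : ∀ {n} → (Fin n → ℕ) → ℕ
sumF {zero}  f = 0
sumF {suc n} f = f zero + sumF (f ∘ suc)

andF : ∀ {n} → (Fin n → Bool) → Bool
andF {zero}  f = true
andF {suc n} f = f zero ∧ andF (f ∘ suc)

sum-allFin : ∀ n (f : Fin n → ℕ) → sum (map f (allFin n)) ≡ sumF f
sum-allFin n f = trans (cong sum (map-tabulate (λ i → i) f)) (sum-tabulate n f)
  where
  sum-tabulate : ∀ n (f : Fin n → ℕ) → sum (tabulate f) ≡ sumF f
  sum-tabulate zero    f = refl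
  sum-tabulate (suc n) f = cong (λ x → f zero + x) (sum-tabulate n (f ∘ suc))

all-allFin : ∀ n (f : Fin n → Bool) → all f (allFin n) ≡ andF f
all-allFin n f = trans (cong and (map-tabulate (λ i → i) f)) (and-tabulate n f)
  where
  and-tabulate : ∀ n (f : Fin n → Bool) → and (tabulate f) ≡ andF f
  and-tabulate zero    f = refl
  and-tabulate (suc n) f = cong (f zero ∧_) (and-tabulate n (f ∘ suc))

sumF-cong : ∀ {n} {f g : Fin n → ℕ} → (∀ i → f i ≡ g i) → sumF f ≡ sumF g
sumF-cong {zero}  e = refl
sumF-cong {suc n} e = cong₂ _+_ (e zero) (sumF-cong (e ∘ suc))

sumF-+ : ∀ {n} (f g : Fin n → ℕ) → sumF (λ i → f i + g i) ≡ sumF f + sumF g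
sumF-+ {zero}  f g = refl
sumF-+ {suc n} f g rewrite sumF-+ (f ∘ suc) (g ∘ suc) =
  +-interchange (f zero) (g zero) (sumF (f ∘ suc)) (sumF (g ∘ suc))

sumF-≤ : ∀ {n} (f : Fin n → ℕ) c → (∀ i → f i ≤ c) → sumF f ≤ n * c
sumF-≤ {zero}  f c h = z≤n
sumF-≤ {suc n} f c h = +-mono-≤ (h zero) (sumF-≤ (f ∘ suc) c (h ∘ suc))

andF-cong : ∀ {n} {f g : Fin n → Bool} → (∀ i → f i ≡ g i) → andF f ≡ andF g
andF-cong {zero}  e = refl
andF-cong {suc n} e = cong₂ _∧_ (e zero) (andF-cong (e ∘ suc))

andF-true : ∀ {n} {f : Fin n → Bool} → (∀ i → f i ≡ true) → andF f ≡ true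
andF-true {zero}      e = refl
andF-true {suc n} {f} e rewrite e zero = andF-true (e ∘ suc)

andF-∧ : ∀ {n} (f g : Fin n → Bool) → andF (λ i → f i ∧ g i) ≡ andF f ∧ andF g
andF-∧ {zero}  f g = refl
andF-∧ {suc n} f g rewrite andF-∧ (f ∘ suc) (g ∘ suc) with f zero | g zero
... | true  | true  = refl
... | true  | false = ≡-sym (∧-zeroʳ (andF (f ∘ suc)))
... | false | _     = refl

andF-mono : ∀ {n} {f g : Fin n → Bool} →
            (∀ i → f i ≡ true → g i ≡ true) → andF f ≡ true → andF g ≡ true
andF-mono {zero}          h e = refl
andF-mono {suc n} {f} {g} h e with f zero in eq
... | true rewrite h zero eq = andF-mono (h ∘ suc) e

sumSubsets : ∀ n → (Subset n → ℕ) → ℕ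
sumSubsets zero    w = w []
sumSubsets (suc n) w = sumSubsets n (w ∘ (true ∷_)) + sumSubsets n (w ∘ (false ∷_))

sum-allSubsets : ∀ n (w : Subset n → ℕ) → sum (map w (allSubsets n)) ≡ sumSubsets n w
sum-allSubsets zero    w = +-identityʳ (w [])
sum-allSubsets (suc n) w = begin
    sum (map w (map (true ∷_) A ++ map (false ∷_) A))
  ≡⟨ cong sum (map-++ w (map (true ∷_) A) (map (false ∷_) A)) ⟩
    sum (map w (map (true ∷_) A) ++ map w (map (false ∷_) A))
  ≡⟨ sum-++ (map w (map (true ∷_) A)) _ ⟩
    sum (map w (map (true ∷_) A)) + sum (map w (map (false ∷_) A))
  ≡⟨ cong₂ _+_ (cong sum (≡-sym (map-∘ A))) (cong sum (≡-sym (map-∘ A))) ⟩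
    sum (map (w ∘ (true ∷_)) A) + sum (map (w ∘ (false ∷_)) A)
  ≡⟨ cong₂ _+_ (sum-allSubsets n _) (sum-allSubsets n _) ⟩
    sumSubsets (suc n) w ∎
  where
  open ≡-Reasoning
  A = allSubsets n

sumSubsets-cong : ∀ n {w v : Subset n → ℕ} → (∀ S → w S ≡ v S) → sumSubsets n w ≡ sumSubsets n v
sumSubsets-cong zero    e = e []
sumSubsets-cong (suc n) e =
  cong₂ _+_ (sumSubsets-cong n (e ∘ (true ∷_))) (sumSubsets-cong n (e ∘ (false ∷_)))

sumSubsets-mono : ∀ n {w v : Subset n → ℕ} → (∀ S → w S ≤ v S) → sumSubsets n w ≤ sumSubsets n v
sumSubsets-mono zero    e = e []
sumSubsets-mono (suc n) e =
  +-mono-≤ (sumSubsets-mono n (e ∘ (true ∷_))) (sumSubsets-mono n (e ∘ (false ∷_)))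

sumSubsets-zero : ∀ n → sumSubsets n (λ _ → 0) ≡ 0
sumSubsets-zero zero    = refl
sumSubsets-zero (suc n) = cong₂ _+_ (sumSubsets-zero n) (sumSubsets-zero n)

sumSubsets-+ : ∀ n (w v : Subset n → ℕ) →
               sumSubsets n (λ S → w S + v S) ≡ sumSubsets n w + sumSubsets n v
sumSubsets-+ zero    w v = refl
sumSubsets-+ (suc n) w v
  rewrite sumSubsets-+ n (w ∘ (true ∷_)) (v ∘ (true ∷_))
        | sumSubsets-+ n (w ∘ (false ∷_)) (v ∘ (false ∷_)) =
  +-interchange (sumSubsets n (w ∘ (true ∷_))) _ _ _

sumSubsets-⊥ : ∀ n (w : Subset n → ℕ) → w ⊥ ≤ sumSubsets n w
sumSubsets-⊥ zero    w = ≤-refl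
sumSubsets-⊥ (suc n) w = ≤-trans (sumSubsets-⊥ n (w ∘ (false ∷_))) (m≤n+m _ _)

sumSubsets-size≡0 : ∀ n → sumSubsets n (λ S → ind (∣ S ∣ ≡ᵇ 0)) ≡ 1
sumSubsets-size≡0 zero    = refl
sumSubsets-size≡0 (suc n) = cong₂ _+_ (sumSubsets-zero n) (sumSubsets-size≡0 n)

sumSubsets-size≡1 : ∀ n → sumSubsets n (λ S → ind (∣ S ∣ ≡ᵇ 1)) ≡ n
sumSubsets-size≡1 zero    = refl
sumSubsets-size≡1 (suc n) = cong₂ _+_ (sumSubsets-size≡0 n) (sumSubsets-size≡1 n)

-- Cliques

_≈ᴳ_ : ∀ {n} → Graph n → Graph n → Set
G ≈ᴳ H = ∀ i j → adj G i j ≡ adj H i j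

tailGraph : ∀ {n} → Graph (suc n) → Graph n
tailGraph G = record
  { adj    = λ i j → adj G (suc i) (suc j)
  ; sym    = λ i j → Graph.sym G (suc i) (suc j)
  ; irrefl = λ i → irrefl G (suc i)
  }

⊆nbhd₀ : ∀ {n} → Graph (suc n) → Subset n → Bool
⊆nbhd₀ G S = andF (λ j → not (lookup S j) ∨ adj G zero (suc j))

cliquePair : ∀ {n} → Graph n → Subset n → Fin n → Fin n → Bool
cliquePair G S i j = not (lookup S i ∧ lookup S j) ∨ isYes (i ≟ j) ∨ adj G i j

isClique-andF : ∀ {n} (G : Graph n) S → isClique G S ≡ andF (λ i → andF (cliquePair G S i))
isClique-andF {n} G S = trans (all-allFin n _) (andF-cong {n} (λ i → all-allFin n _))

isClique-cong : ∀ {n} (G H : Graph n) → G ≈ᴳ H → ∀ S → isClique G S ≡ isClique H S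
isClique-cong G H G≈H S = begin
    isClique G S
  ≡⟨ isClique-andF G S ⟩
    andF (λ i → andF (cliquePair G S i))
  ≡⟨ andF-cong (λ i → andF-cong (λ j → cong (λ x → not (lookup S i ∧ lookup S j) ∨ isYes (i ≟ j) ∨ x) (G≈H i j))) ⟩
    andF (λ i → andF (cliquePair H S i))
  ≡⟨ ≡-sym (isClique-andF H S) ⟩
    isClique H S ∎
  where open ≡-Reasoning

isYes-suc≟suc : ∀ {n} (i j : Fin n) → isYes (Fin.suc i ≟ suc j) ≡ isYes (i ≟ j)
isYes-suc≟suc i j with i ≟ j
... | yes _ = refl
... | no  _ = refl

isClique-∷ : ∀ {n} (G : Graph (suc n)) b S →
             isClique G (b ∷ S) ≡ (not b ∨ ⊆nbhd₀ G S) ∧ isClique (tailGraph G) S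
isClique-∷ {n} G b S = begin
    isClique G (b ∷ S)
  ≡⟨ isClique-andF G (b ∷ S) ⟩
    (pair zero zero ∧ andF (pair zero ∘ suc)) ∧ andF (λ i → pair (suc i) zero ∧ tailPairs b i)
  ≡⟨ split b ⟩
    (not b ∨ ⊆nbhd₀ G S) ∧ C
  ≡⟨ cong ((not b ∨ ⊆nbhd₀ G S) ∧_) (≡-sym (isClique-andF (tailGraph G) S)) ⟩
    (not b ∨ ⊆nbhd₀ G S) ∧ isClique (tailGraph G) S ∎
  where
  open ≡-Reasoning
  pair : Fin (suc n) → Fin (suc n) → Bool
  pair = cliquePair G (b ∷ S)
  C : Bool
  C = andF (λ i → andF (cliquePair (tailGraph G) S i))
  tailPairs : Bool → Fin n → Bool
  tailPairs b i = andF (λ j → cliquePair G (b ∷ S) (suc i) (suc j))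
  tailPairs≡ : ∀ b i → tailPairs b i ≡ andF (cliquePair (tailGraph G) S i)
  tailPairs≡ b i = andF-cong (λ j →
    cong (λ x → not (lookup S i ∧ lookup S j) ∨ x ∨ adj G (suc i) (suc j)) (isYes-suc≟suc i j))
  pair-in : ∀ i → cliquePair G (true ∷ S) (suc i) zero ≡ not (lookup S i) ∨ adj G zero (suc i)
  pair-in i = cong₂ (λ x y → not x ∨ y) (∧-identityʳ (lookup S i)) (Graph.sym G (suc i) zero)
  pair-out : ∀ i → cliquePair G (false ∷ S) (suc i) zero ≡ true
  pair-out i = cong (λ x → not x ∨ false ∨ adj G (suc i) zero) (∧-zeroʳ (lookup S i))
  split : ∀ b → (cliquePair G (b ∷ S) zero zero ∧ andF (cliquePair G (b ∷ S) zero ∘ suc))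
                  ∧ andF (λ i → cliquePair G (b ∷ S) (suc i) zero ∧ tailPairs b i)
                ≡ (not b ∨ ⊆nbhd₀ G S) ∧ C
  split true = begin
      ⊆nbhd₀ G S ∧ andF (λ i → cliquePair G (true ∷ S) (suc i) zero ∧ tailPairs true i)
    ≡⟨ cong (⊆nbhd₀ G S ∧_) (andF-∧ {n} _ _) ⟩
      ⊆nbhd₀ G S ∧ (andF (λ i → cliquePair G (true ∷ S) (suc i) zero) ∧ andF (tailPairs true))
    ≡⟨ cong₂ (λ x y → ⊆nbhd₀ G S ∧ (x ∧ y)) (andF-cong pair-in) (andF-cong (tailPairs≡ true)) ⟩
      ⊆nbhd₀ G S ∧ (⊆nbhd₀ G S ∧ C)
    ≡⟨ ≡-sym (∧-assoc (⊆nbhd₀ G S) (⊆nbhd₀ G S) C) ⟩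
      (⊆nbhd₀ G S ∧ ⊆nbhd₀ G S) ∧ C
    ≡⟨ cong (_∧ C) (∧-idem (⊆nbhd₀ G S)) ⟩
      ⊆nbhd₀ G S ∧ C ∎
  split false = begin
      andF {n} (λ _ → true) ∧ andF (λ i → cliquePair G (false ∷ S) (suc i) zero ∧ tailPairs false i)
    ≡⟨ cong₂ _∧_ (andF-true {n} (λ _ → refl)) (andF-∧ {n} _ _) ⟩
      andF (λ i → cliquePair G (false ∷ S) (suc i) zero) ∧ andF (tailPairs false)
    ≡⟨ cong₂ _∧_ (andF-true pair-out) (andF-cong (tailPairs≡ false)) ⟩
      C ∎

cliques : ∀ {n} → Graph n → (Subset n → Bool) → ℕ
cliques {n} G P = sumSubsets n (λ S → ind (P S ∧ isClique G S))

allCliques : ∀ {n} → Graph n → ℕ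
allCliques G = cliques G (λ _ → true)

k≡cliques : ∀ {n} (G : Graph n) t → k_ G t ≡ cliques G (λ S → ∣ S ∣ ≡ᵇ t)
k≡cliques {n} G t = sum-allSubsets n _

cliques-∷ : ∀ {n} (G : Graph (suc n)) P →
            cliques G P ≡ cliques (tailGraph G) (λ S → P (true ∷ S) ∧ ⊆nbhd₀ G S)
                        + cliques (tailGraph G) (λ S → P (false ∷ S))
cliques-∷ {n} G P = cong₂ _+_
  (sumSubsets-cong n (λ S → cong ind (trans (cong (P (true ∷ S) ∧_) (isClique-∷ G true S))
                                            (≡-sym (∧-assoc (P (true ∷ S)) (⊆nbhd₀ G S) _)))))
  (sumSubsets-cong n (λ S → cong ind (cong (P (false ∷ S) ∧_) (isClique-∷ G false S))))

cliques-cong : ∀ {n} (G H : Graph n) → G ≈ᴳ H → ∀ P → cliques G P ≡ cliques H P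
cliques-cong {n} G H G≈H P = sumSubsets-cong n (λ S → cong (λ c → ind (P S ∧ c)) (isClique-cong G H G≈H S))

cliques-mono : ∀ {n} (G : Graph n) {P Q} → (∀ S → P S ≡ true → Q S ≡ true) → cliques G P ≤ cliques G Q
cliques-mono {n} G {P} {Q} P⇒Q = sumSubsets-mono n (λ S → ind-mono (∧-monoˡ (P⇒Q S)))
  where
  ∧-monoˡ : ∀ {p q c} → (p ≡ true → q ≡ true) → p ∧ c ≡ true → q ∧ c ≡ true
  ∧-monoˡ {true} p⇒q e rewrite p⇒q refl = e

cliques-≤-subsets : ∀ {n} (G : Graph n) P → cliques G P ≤ sumSubsets n (ind ∘ P)
cliques-≤-subsets {n} G P = sumSubsets-mono n (λ S → ind-mono (∧-conicalˡ (P S) _))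

k-cong : ∀ {n} (G H : Graph n) → G ≈ᴳ H → ∀ t → k_ G t ≡ k_ H t
k-cong G H G≈H t = trans (k≡cliques G t) (trans (cliques-cong G H G≈H _) (≡-sym (k≡cliques H t)))

k₀≤1 : ∀ {n} (G : Graph n) → k_ G 0 ≤ 1
k₀≤1 {n} G = ≤-trans (≤-reflexive (k≡cliques G 0))
                     (≤-trans (cliques-≤-subsets G _) (≤-reflexive (sumSubsets-size≡0 n)))

k₁≤n : ∀ {n} (G : Graph n) → k_ G 1 ≤ n
k₁≤n {n} G = ≤-trans (≤-reflexive (k≡cliques G 1))
                     (≤-trans (cliques-≤-subsets G _) (≤-reflexive (sumSubsets-size≡1 n)))

lookup-⊥ : ∀ {n} (i : Fin n) → lookup ⊥ i ≡ false
lookup-⊥ i = lookup-replicate i false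

isClique-⊥ : ∀ {n} (G : Graph n) → isClique G ⊥ ≡ true
isClique-⊥ {n} G = trans (isClique-andF G ⊥) (andF-true {n} (λ i → andF-true {n} (λ j →
  cong (λ x → not (x ∧ lookup ⊥ j) ∨ isYes (i ≟ j) ∨ adj G i j) (lookup-⊥ i))))

sumDegrees : ∀ {n} → Graph n → ℕ
sumDegrees G = sumF (degree G)

degree₀ : ∀ {n} → Graph (suc n) → ℕ
degree₀ G = sumF (λ j → ind (adj G zero (suc j)))

degree-sumF : ∀ {n} (G : Graph n) v → degree G v ≡ sumF (ind ∘ adj G v)
degree-sumF {n} G v = sum-allFin n _

degree-cong : ∀ {n} (G H : Graph n) → G ≈ᴳ H → ∀ v → degree G v ≡ degree H v
degree-cong G H G≈H v =
  trans (degree-sumF G v) (trans (sumF-cong (cong ind ∘ G≈H v)) (≡-sym (degree-sumF H v)))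

sumDegrees-∷ : ∀ {n} (G : Graph (suc n)) → sumDegrees G ≡ degree₀ G + (degree₀ G + sumDegrees (tailGraph G))
sumDegrees-∷ {n} G = begin
    sumDegrees G
  ≡⟨ sumF-cong (degree-sumF G) ⟩
    (ind (adj G zero zero) + degree₀ G) + sumF (λ j → sumF (ind ∘ adj G (suc j)))
  ≡⟨ cong₂ _+_ (cong (λ x → ind x + degree₀ G) (irrefl G zero)) (sumF-+ {n} _ _) ⟩
    degree₀ G + (sumF (λ j → ind (adj G (suc j) zero)) + sumF (λ j → sumF (ind ∘ adj G (suc j) ∘ suc)))
  ≡⟨ cong (λ x → degree₀ G + (x + sumF (λ j → sumF (ind ∘ adj G (suc j) ∘ suc)))) (sumF-cong (λ j → cong ind (Graph.sym G (suc j) zero))) ⟩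
    degree₀ G + (degree₀ G + sumF (λ j → sumF (ind ∘ adj G (suc j) ∘ suc)))
  ≡⟨ cong (λ x → degree₀ G + (degree₀ G + x)) (≡-sym (sumF-cong (degree-sumF (tailGraph G)))) ⟩
    degree₀ G + (degree₀ G + sumDegrees (tailGraph G)) ∎
  where open ≡-Reasoning

edges-at-0≤degree₀ : ∀ {n} (G : Graph (suc n)) → cliques (tailGraph G) (λ S → (∣ S ∣ ≡ᵇ 1) ∧ ⊆nbhd₀ G S) ≤ degree₀ G
edges-at-0≤degree₀ {n} G =
  ≤-trans (cliques-≤-subsets (tailGraph G) _) (singletons≤ n (λ j → adj G zero (suc j)))
  where
  singletons≤ : ∀ n (h : Fin n → Bool) →
    sumSubsets n (λ S → ind ((∣ S ∣ ≡ᵇ 1) ∧ andF (λ j → not (lookup S j) ∨ h j))) ≤ sumF (ind ∘ h)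
  singletons≤ zero    h = z≤n
  singletons≤ (suc n) h = +-mono-≤ first (singletons≤ n (h ∘ suc))
    where
    first : sumSubsets n (λ S → ind ((∣ S ∣ ≡ᵇ 0) ∧ (h zero ∧ andF (λ j → not (lookup S j) ∨ h (suc j)))))
          ≤ ind (h zero)
    first with h zero
    ... | true  = ≤-trans (sumSubsets-mono n (λ S → ind-mono (∧-conicalˡ (∣ S ∣ ≡ᵇ 0) _)))
                          (≤-reflexive (sumSubsets-size≡0 n))
    ... | false = ≤-reflexive (trans (sumSubsets-cong n (λ S → cong ind (∧-zeroʳ (∣ S ∣ ≡ᵇ 0))))
                                     (sumSubsets-zero n))

handshake : ∀ {n} (G : Graph n) → k_ G 2 + k_ G 2 ≤ sumDegrees G
handshake {zero}  G = z≤n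
handshake {suc n} G = begin
    k_ G 2 + k_ G 2
  ≡⟨ cong₂ _+_ k₂-∷ k₂-∷ ⟩
    (E₀ + k_ (tailGraph G) 2) + (E₀ + k_ (tailGraph G) 2)
  ≡⟨ +-interchange E₀ _ E₀ _ ⟩
    (E₀ + E₀) + (k_ (tailGraph G) 2 + k_ (tailGraph G) 2)
  ≤⟨ +-mono-≤ (+-mono-≤ (edges-at-0≤degree₀ G) (edges-at-0≤degree₀ G)) (handshake (tailGraph G)) ⟩
    (degree₀ G + degree₀ G) + sumDegrees (tailGraph G)
  ≡⟨ +-assoc (degree₀ G) (degree₀ G) _ ⟩
    degree₀ G + (degree₀ G + sumDegrees (tailGraph G))
  ≡⟨ ≡-sym (sumDegrees-∷ G) ⟩
    sumDegrees G ∎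
  where
  open ≤-Reasoning
  E₀ = cliques (tailGraph G) (λ S → (∣ S ∣ ≡ᵇ 1) ∧ ⊆nbhd₀ G S)
  k₂-∷ : k_ G 2 ≡ E₀ + k_ (tailGraph G) 2
  k₂-∷ = trans (k≡cliques G 2) (trans (cliques-∷ G (λ S → ∣ S ∣ ≡ᵇ 2)) (cong (λ x → E₀ + x) (≡-sym (k≡cliques (tailGraph G) 2))))

2k₂≤nΔ : ∀ {n} (G : Graph n) r → MaxDegree≤ G r → k_ G 2 + k_ G 2 ≤ n * r
2k₂≤nΔ G r Δ≤r = ≤-trans (handshake G) (sumF-≤ (degree G) r Δ≤r)

∑< : ℕ → (ℕ → ℕ) → ℕ
∑< zero    f = 0
∑< (suc m) f = f 0 + ∑< m (f ∘ suc)

infixl 10 ∑<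
syntax ∑< m (λ t → e) = ∑[ t < m ] e

kTotal≡∑ : ∀ {n} (G : Graph n) → kTotal G ≡ ∑[ t < suc n ] (k_ G t)
kTotal≡∑ {n} G = sum-applyUpTo (k_ G) (λ t → t) (suc n)
  where
  sum-applyUpTo : ∀ (f g : ℕ → ℕ) m → sum (map f (applyUpTo g m)) ≡ ∑< m (f ∘ g)
  sum-applyUpTo f g zero    = refl
  sum-applyUpTo f g (suc m) = cong (λ x → f (g 0) + x) (sum-applyUpTo f (g ∘ suc) m)

∑-cong : ∀ {f g : ℕ → ℕ} m → (∀ t → f t ≡ g t) → ∑< m f ≡ ∑< m g
∑-cong zero    e = refl
∑-cong (suc m) e = cong₂ _+_ (e 0) (∑-cong m (e ∘ suc))

∑-mono : ∀ {f g : ℕ → ℕ} m → (∀ t → f t ≤ g t) → ∑< m f ≤ ∑< m g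
∑-mono zero    e = z≤n
∑-mono (suc m) e = +-mono-≤ (e 0) (∑-mono m (e ∘ suc))

∑-+ : ∀ (f g : ℕ → ℕ) m → ∑[ t < m ] (f t + g t) ≡ ∑< m f + ∑< m g
∑-+ f g zero    = refl
∑-+ f g (suc m) rewrite ∑-+ (f ∘ suc) (g ∘ suc) m = +-interchange (f 0) (g 0) _ _

∑-* : ∀ c (f : ℕ → ℕ) m → ∑[ t < m ] (c * f t) ≡ c * ∑< m f
∑-* c f zero    = ≡-sym (*-zeroʳ c)
∑-* c f (suc m) = trans (cong (λ x → c * f 0 + x) (∑-* c (f ∘ suc) m)) (≡-sym (*-distribˡ-+ c (f 0) _))

∑-sumSubsets : ∀ n (w : ℕ → Subset n → ℕ) m →
               ∑[ t < m ] (sumSubsets n (w t)) ≡ sumSubsets n (λ S → ∑[ t < m ] w t S)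
∑-sumSubsets n w zero    = ≡-sym (sumSubsets-zero n)
∑-sumSubsets n w (suc m) =
  trans (cong (λ x → sumSubsets n (w 0) + x) (∑-sumSubsets n (w ∘ suc) m)) (≡-sym (sumSubsets-+ n (w 0) _))

cliques≤kTotal : ∀ {n} (G : Graph n) → allCliques G ≤ kTotal G
cliques≤kTotal {n} G = begin
    sumSubsets n (λ S → ind (isClique G S))
  ≤⟨ sumSubsets-mono n (λ S → ind≤∑-size (isClique G S) (∣p∣≤n S)) ⟩
    sumSubsets n (λ S → ∑[ t < suc n ] (ind ((∣ S ∣ ≡ᵇ t) ∧ isClique G S)))
  ≡⟨ ≡-sym (∑-sumSubsets n (λ t S → ind ((∣ S ∣ ≡ᵇ t) ∧ isClique G S)) (suc n)) ⟩
    ∑[ t < suc n ] (cliques G (λ S → ∣ S ∣ ≡ᵇ t))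
  ≡⟨ ≡-sym (trans (kTotal≡∑ G) (∑-cong (suc n) (k≡cliques G))) ⟩
    kTotal G ∎
  where
  open ≤-Reasoning
  ind≤∑-size : ∀ c {x m} → x ≤ m → ind c ≤ ∑[ t < suc m ] (ind ((x ≡ᵇ t) ∧ c))
  ind≤∑-size c {zero}              _         = m≤m+n (ind c) _
  ind≤∑-size c {suc x} {suc m} (s≤s x≤m) = ind≤∑-size c x≤m

-- Binomial coefficients

[1+k]*nC[1+k] : ∀ n k → suc k * (n C suc k) ≡ (n ∸ k) * (n C k)
[1+k]*nC[1+k] zero    zero    = refl
[1+k]*nC[1+k] zero    (suc k) = *-zeroʳ (suc (suc k))
[1+k]*nC[1+k] (suc n) zero    = trans (+-identityʳ (suc n C 1)) (trans (nC1≡n (suc n)) (≡-sym (*-identityʳ (suc n))))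
[1+k]*nC[1+k] (suc n) (suc k) = begin
    suc (suc k) * (suc n C suc (suc k))
  ≡⟨ cong (suc (suc k) *_) (≡-sym (nCk+nC[k+1]≡[n+1]C[k+1] n (suc k))) ⟩
    suc (suc k) * (n C suc k + n C suc (suc k))
  ≡⟨ *-distribˡ-+ (suc (suc k)) (n C suc k) _ ⟩
    (n C suc k + suc k * (n C suc k)) + suc (suc k) * (n C suc (suc k))
  ≡⟨ cong₂ (λ x y → (n C suc k + x) + y) ([1+k]*nC[1+k] n k) ([1+k]*nC[1+k] n (suc k)) ⟩
    (n C suc k + (n ∸ k) * (n C k)) + (n ∸ suc k) * (n C suc k)
  ≡⟨ rearrange (n C suc k) ((n ∸ k) * (n C k)) ((n ∸ suc k) * (n C suc k)) ⟩
    (n ∸ k) * (n C k) + (n C suc k + (n ∸ suc k) * (n C suc k))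
  ≡⟨ cong (λ x → (n ∸ k) * (n C k) + x) absorb ⟩
    (n ∸ k) * (n C k) + (n ∸ k) * (n C suc k)
  ≡⟨ ≡-sym (*-distribˡ-+ (n ∸ k) (n C k) _) ⟩
    (n ∸ k) * (n C k + n C suc k)
  ≡⟨ cong ((n ∸ k) *_) (nCk+nC[k+1]≡[n+1]C[k+1] n k) ⟩
    (n ∸ k) * (suc n C suc k) ∎
  where
  open ≡-Reasoning
  rearrange : ∀ a b c → (a + b) + c ≡ b + (a + c)
  rearrange = solve-∀
  absorb : n C suc k + (n ∸ suc k) * (n C suc k) ≡ (n ∸ k) * (n C suc k)
  absorb with k <? n
  ... | yes k<n = cong (_* (n C suc k)) (≡-sym (+-∸-assoc 1 k<n))
  ... | no  k≮n rewrite k>n⇒nCk≡0 (s≤s (≮⇒≥ k≮n)) = trans (*-zeroʳ (n ∸ suc k)) (≡-sym (*-zeroʳ (n ∸ k)))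

∑-binomial≤2^ : ∀ r m → ∑[ t < m ] (r C t) ≤ 2 ^ r
∑-binomial≤2^ zero    zero    = z≤n
∑-binomial≤2^ zero    (suc m) = ≤-reflexive (cong suc (∑-zero m))
  where
  ∑-zero : ∀ m → ∑[ t < m ] (0 C suc t) ≡ 0
  ∑-zero zero    = refl
  ∑-zero (suc m) = ∑-zero m
∑-binomial≤2^ (suc r) zero    = z≤n
∑-binomial≤2^ (suc r) (suc m) = begin
    1 + ∑[ t < m ] (suc r C suc t)
  ≡⟨ cong suc (∑-cong m (λ t → ≡-sym (nCk+nC[k+1]≡[n+1]C[k+1] r t))) ⟩
    1 + ∑[ t < m ] (r C t + r C suc t)
  ≡⟨ cong suc (∑-+ (r C_) (λ t → r C suc t) m) ⟩
    1 + (∑[ t < m ] (r C t) + ∑[ t < m ] (r C suc t))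
  ≡⟨ cong suc (+-comm (∑[ t < m ] (r C t)) _) ⟩
    ∑[ t < suc m ] (r C t) + ∑[ t < m ] (r C t)
  ≤⟨ +-mono-≤ (∑-binomial≤2^ r (suc m)) (∑-binomial≤2^ r m) ⟩
    2 ^ r + 2 ^ r
  ≡⟨ cong (λ x → 2 ^ r + x) (≡-sym (+-identityʳ (2 ^ r))) ⟩
    2 ^ suc r ∎
  where open ≤-Reasoning

-- The ratio condition

CliqueRatio : ℕ → ∀ {n} → Graph n → Set
CliqueRatio r G = ∀ (t : ℕ) → 3 ≤ t → (+ t) *ℤ (+ k_ G t) ≤ℤ ((+ (r + 1)) - (+ t)) *ℤ (+ k_ G (t ∸ 1))

m⊖n≤m∸n : ∀ m n → m ⊖ n ≤ℤ + (m ∸ n)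
m⊖n≤m∸n m n with n ≤? m
... | yes n≤m = ℤ.≤-reflexive (⊖-≥ n≤m)
... | no  n≰m rewrite ⊖-< (≰⇒> n≰m) = neg-≤-pos

ratioℤ⇒ratioℕ : ∀ r (f : ℕ → ℕ) →
  (∀ t → 3 ≤ t → (+ t) *ℤ (+ f t) ≤ℤ ((+ (r + 1)) - (+ t)) *ℤ (+ f (t ∸ 1))) →
  ∀ t → 2 ≤ t → suc t * f (suc t) ≤ (r ∸ t) * f t
ratioℤ⇒ratioℕ r f ratio t 2≤t = drop‿+≤+ (begin
    + (suc t * f (suc t))              ≡⟨ pos-* (suc t) (f (suc t)) ⟩
    + suc t *ℤ + f (suc t)             ≤⟨ ratio (suc t) (s≤s 2≤t) ⟩
    (+ (r + 1) - + suc t) *ℤ + f t     ≡⟨ cong (_*ℤ + f t) r+1-[1+t]≡r⊖t ⟩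
    (r ⊖ t) *ℤ + f t                   ≤⟨ *-monoʳ-≤-nonNeg (+ f t) (m⊖n≤m∸n r t) ⟩
    + (r ∸ t) *ℤ + f t                 ≡⟨ ≡-sym (pos-* (r ∸ t) (f t)) ⟩
    + ((r ∸ t) * f t)                  ∎)
  where
  open ℤ.≤-Reasoning
  r+1-[1+t]≡r⊖t : + (r + 1) - + suc t ≡ r ⊖ t
  r+1-[1+t]≡r⊖t = trans ([+m]-[+n]≡m⊖n (r + 1) (suc t))
                        (trans (cong (_⊖ suc t) (+-comm r 1)) ([1+m]⊖[1+n]≡m⊖n r t))

ratio⇒vanishing : ∀ r (f : ℕ → ℕ) → (∀ t → 2 ≤ t → suc t * f (suc t) ≤ (r ∸ t) * f t) →
  ∀ t → 2 ≤ t → r ≤ t → f (suc t) ≡ 0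
ratio⇒vanishing r f ratio t 2≤t r≤t = n≤0⇒n≡0 (begin
  f (suc t)               ≤⟨ m≤n*m (f (suc t)) (suc t) ⟩
  suc t * f (suc t)       ≤⟨ ratio t 2≤t ⟩
  (r ∸ t) * f t           ≡⟨ cong (_* f t) (m≤n⇒m∸n≡0 r≤t) ⟩
  0                       ∎)
  where open ≤-Reasoning

ratio⇒binomial-bound : ∀ (f : ℕ → ℕ) r n → f 2 + f 2 ≤ n * r →
  (∀ t → 2 ≤ t → suc t * f (suc t) ≤ (r ∸ t) * f t) →
  ∀ t → (r ∸ 1) * f (2 + t) ≤ n * (r C (2 + t))
ratio⇒binomial-bound f r n 2f₂≤nr ratio zero = *-cancelˡ-≤ 2 (begin
    2 * ((r ∸ 1) * f 2)
  ≡⟨ x*[y*z]≡y*[x*z] 2 (r ∸ 1) (f 2) ⟩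
    (r ∸ 1) * (f 2 + (f 2 + 0))
  ≡⟨ cong (λ x → (r ∸ 1) * (f 2 + x)) (+-identityʳ (f 2)) ⟩
    (r ∸ 1) * (f 2 + f 2)
  ≤⟨ *-monoʳ-≤ (r ∸ 1) 2f₂≤nr ⟩
    (r ∸ 1) * (n * r)
  ≡⟨ x*[y*z]≡y*[x*z] (r ∸ 1) n r ⟩
    n * ((r ∸ 1) * r)
  ≡⟨ cong (λ x → n * ((r ∸ 1) * x)) (≡-sym (nC1≡n r)) ⟩
    n * ((r ∸ 1) * (r C 1))
  ≡⟨ cong (n *_) (≡-sym ([1+k]*nC[1+k] r 1)) ⟩
    n * (2 * (r C 2))
  ≡⟨ x*[y*z]≡y*[x*z] n 2 (r C 2) ⟩
    2 * (n * (r C 2)) ∎)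
  where open ≤-Reasoning
ratio⇒binomial-bound f r n 2f₂≤nr ratio (suc t) = *-cancelˡ-≤ (3 + t) (begin
    (3 + t) * ((r ∸ 1) * f (3 + t))
  ≡⟨ x*[y*z]≡y*[x*z] (3 + t) (r ∸ 1) (f (3 + t)) ⟩
    (r ∸ 1) * ((3 + t) * f (3 + t))
  ≤⟨ *-monoʳ-≤ (r ∸ 1) (ratio (2 + t) (s≤s (s≤s z≤n))) ⟩
    (r ∸ 1) * ((r ∸ (2 + t)) * f (2 + t))
  ≡⟨ x*[y*z]≡y*[x*z] (r ∸ 1) (r ∸ (2 + t)) (f (2 + t)) ⟩
    (r ∸ (2 + t)) * ((r ∸ 1) * f (2 + t))
  ≤⟨ *-monoʳ-≤ (r ∸ (2 + t)) (ratio⇒binomial-bound f r n 2f₂≤nr ratio t) ⟩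
    (r ∸ (2 + t)) * (n * (r C (2 + t)))
  ≡⟨ x*[y*z]≡y*[x*z] (r ∸ (2 + t)) n (r C (2 + t)) ⟩
    n * ((r ∸ (2 + t)) * (r C (2 + t)))
  ≡⟨ cong (n *_) (≡-sym ([1+k]*nC[1+k] r (2 + t))) ⟩
    n * ((3 + t) * (r C (3 + t)))
  ≡⟨ x*[y*z]≡y*[x*z] n (3 + t) (r C (3 + t)) ⟩
    (3 + t) * (n * (r C (3 + t))) ∎)
  where open ≤-Reasoning

-- s · Σ f ≤ s (1 + n) + n (2^r - 1 - r), written without subtraction.
∑-binomial-bound : ∀ (f : ℕ → ℕ) r n s m → f 0 ≤ 1 → f 1 ≤ n →
  (∀ t → s * f (2 + t) ≤ n * (r C (2 + t))) →
  s * ∑< (2 + m) f + n * suc r ≤ s * suc n + n * 2 ^ r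
∑-binomial-bound f r n s m f₀≤1 f₁≤n f≤C = begin
    s * (f 0 + (f 1 + ∑[ t < m ] f (2 + t))) + n * suc r
  ≡⟨ distrib s (f 0) (f 1) (∑[ t < m ] f (2 + t)) (n * suc r) ⟩
    (s * f 0 + (s * f 1 + s * ∑[ t < m ] f (2 + t))) + n * suc r
  ≤⟨ +-monoˡ-≤ (n * suc r) (+-mono-≤ (*-monoʳ-≤ s f₀≤1) (+-mono-≤ (*-monoʳ-≤ s f₁≤n) tail≤)) ⟩
    (s * 1 + (s * n + n * ∑[ t < m ] (r C (2 + t)))) + n * suc r
  ≡⟨ collect s n (∑[ t < m ] (r C (2 + t))) r ⟩
    s * suc n + n * (1 + (r + ∑[ t < m ] (r C (2 + t))))
  ≡⟨ cong (λ x → s * suc n + n * (1 + (x + ∑[ t < m ] (r C (2 + t))))) (≡-sym (nC1≡n r)) ⟩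
    s * suc n + n * ∑[ t < 2 + m ] (r C t)
  ≤⟨ +-monoʳ-≤ (s * suc n) (*-monoʳ-≤ n (∑-binomial≤2^ r (2 + m))) ⟩
    s * suc n + n * 2 ^ r ∎
  where
  open ≤-Reasoning
  tail≤ : s * ∑[ t < m ] f (2 + t) ≤ n * ∑[ t < m ] (r C (2 + t))
  tail≤ = begin
    s * ∑[ t < m ] f (2 + t)         ≡⟨ ≡-sym (∑-* s (λ t → f (2 + t)) m) ⟩
    ∑[ t < m ] (s * f (2 + t))       ≤⟨ ∑-mono m f≤C ⟩
    ∑[ t < m ] (n * (r C (2 + t)))   ≡⟨ ∑-* n (λ t → r C (2 + t)) m ⟩
    n * ∑[ t < m ] (r C (2 + t))     ∎
  distrib : ∀ s a b x z → s * (a + (b + x)) + z ≡ (s * a + (s * b + s * x)) + z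
  distrib = solve-∀
  collect : ∀ s n y r → (s * 1 + (s * n + n * y)) + n * suc r ≡ s * suc n + n * (1 + (r + y))
  collect = solve-∀

kTotal-bound : ∀ r {n} (G : Graph n) → MaxDegree≤ G r → CliqueRatio r G →
  (r ∸ 1) * kTotal G + n * suc r ≤ (r ∸ 1) * suc n + n * 2 ^ r
kTotal-bound r {zero} G _ _ rewrite kTotal≡∑ G =
  +-monoˡ-≤ 0 (*-monoʳ-≤ (r ∸ 1) (≤-trans (≤-reflexive (+-identityʳ (k_ G 0))) (k₀≤1 G)))
kTotal-bound r {suc n} G Δ≤r ratio rewrite kTotal≡∑ G =
  ∑-binomial-bound (k_ G) r (suc n) (r ∸ 1) n (k₀≤1 G) (k₁≤n G)
    (ratio⇒binomial-bound (k_ G) r (suc n) (2k₂≤nΔ G r Δ≤r) (ratioℤ⇒ratioℕ r (k_ G) ratio))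

-- Cliques of the block graph

≡ᵇ-sym : ∀ m n → (m ≡ᵇ n) ≡ (n ≡ᵇ m)
≡ᵇ-sym zero    zero    = refl
≡ᵇ-sym zero    (suc n) = refl
≡ᵇ-sym (suc m) zero    = refl
≡ᵇ-sym (suc m) (suc n) = ≡ᵇ-sym m n

isYes-≟-sym : ∀ {m} (i j : Fin m) → isYes (i ≟ j) ≡ isYes (j ≟ i)
isYes-≟-sym i j with i ≟ j | j ≟ i
... | yes _   | yes _   = refl
... | no  _   | no  _   = refl
... | yes i≡j | no  j≢i = contradiction (≡-sym i≡j) j≢i
... | no  i≢j | yes j≡i = contradiction (≡-sym j≡i) i≢j

isYes-≟-refl : ∀ {m} (i : Fin m) → isYes (i ≟ i) ≡ true
isYes-≟-refl i = trans (isYes≗does (i ≟ i)) (dec-true (i ≟ i) refl)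

module _ (r : ℕ) where

  -- The vertices c, c+1, …, c+m-1 of the graph on ℕ whose cliques are the blocks
  -- {q(r+1), …, q(r+1)+r}; blockGraph a r b is segment 0 (a(r+1)+b).
  segment : ℕ → (m : ℕ) → Graph m
  segment c m = record
    { adj    = λ i j → not (isYes (i ≟ j)) ∧ (((c + toℕ i) / suc r) ≡ᵇ ((c + toℕ j) / suc r))
    ; sym    = λ i j → cong₂ (λ x y → not x ∧ y) (isYes-≟-sym i j) (≡ᵇ-sym ((c + toℕ i) / suc r) _)
    ; irrefl = λ i → cong (λ x → not x ∧ ((c + toℕ i) / suc r ≡ᵇ (c + toℕ i) / suc r)) (isYes-≟-refl i)
    }

  SameBlock : ℕ → ℕ → Set
  SameBlock c e = ∀ x y → x < e → y < e → (c + x) / suc r ≡ (c + y) / suc r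

  SameBlock-suc : ∀ c {e} → SameBlock c (suc e) → SameBlock (suc c) e
  SameBlock-suc c same x y x<e y<e =
    trans (cong (_/ suc r) (≡-sym (+-suc c x)))
          (trans (same (suc x) (suc y) (s≤s x<e) (s≤s y<e)) (cong (_/ suc r) (+-suc c y)))

  SameBlock-block : ∀ q {e} → e ≤ suc r → SameBlock (q * suc r) e
  SameBlock-block q e≤r+1 x y x<e y<e =
    trans (quotient x (≤-trans x<e e≤r+1)) (≡-sym (quotient y (≤-trans y<e e≤r+1)))
    where
    quotient : ∀ z → z < suc r → (q * suc r + z) / suc r ≡ q
    quotient z z<r+1 = trans (+-distrib-/-∣ˡ z (n∣m*n q))
      (trans (cong₂ _+_ (m*n/n≡m q (suc r)) (m<n⇒m/n≡0 z<r+1)) (+-identityʳ q))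

  tail-segment : ∀ c m → tailGraph (segment c (suc m)) ≈ᴳ segment (suc c) m
  tail-segment c m i j = cong₂ (λ x y → not x ∧ y) (isYes-suc≟suc i j)
    (cong₂ (λ x y → (x / suc r) ≡ᵇ (y / suc r)) (+-suc c (toℕ i)) (+-suc c (toℕ j)))

  cliques-tail-segment : ∀ c m P → cliques (segment (suc c) m) P ≡ cliques (tailGraph (segment c (suc m))) P
  cliques-tail-segment c m P =
    cliques-cong (segment (suc c) m) (tailGraph (segment c (suc m))) (λ i j → ≡-sym (tail-segment c m i j)) P

  ⊆first : ∀ {m} → ℕ → Subset m → Bool
  ⊆first d S = andF (λ j → not (lookup S j) ∨ (toℕ j <ᵇ d))

  ⊆first⇒⊆nbhd₀ : ∀ c m {d} → SameBlock c (suc d) → ∀ S → ⊆first d S ≡ true → ⊆nbhd₀ (segment c (suc m)) S ≡ true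
  ⊆first⇒⊆nbhd₀ c m {d} same S = andF-mono {m} member⇒adjacent
    where
    member⇒adjacent : ∀ j → (not (lookup S j) ∨ (toℕ j <ᵇ d)) ≡ true →
                      (not (lookup S j) ∨ adj (segment c (suc m)) zero (suc j)) ≡ true
    member⇒adjacent j e with lookup S j
    ... | false = refl
    ... | true  = Equivalence.to T-≡ (≡⇒≡ᵇ _ _ (same 0 (suc (toℕ j)) (s≤s z≤n) (s≤s (<ᵇ⇒< (toℕ j) d (Equivalence.from T-≡ e)))))

  ⊆first-⊥ : ∀ {m} d → ⊆first {m} d ⊥ ≡ true
  ⊆first-⊥ {m} d = andF-true {m} (λ j → cong (λ x → not x ∨ (toℕ j <ᵇ d)) (lookup-⊥ j))

  2^d≤cliques-⊆first : ∀ d c m → d ≤ m → SameBlock c d → 2 ^ d ≤ cliques (segment c m) (⊆first d)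
  2^d≤cliques-⊆first zero c m _ _ =
    ≤-trans (≤-reflexive (cong ind (≡-sym (cong₂ _∧_ (⊆first-⊥ {m} 0) (isClique-⊥ (segment c m))))))
            (sumSubsets-⊥ m _)
  2^d≤cliques-⊆first (suc d) c (suc m) (s≤s d≤m) same = begin
      2 ^ d + (2 ^ d + 0)
    ≡⟨ cong (λ x → 2 ^ d + x) (+-identityʳ (2 ^ d)) ⟩
      2 ^ d + 2 ^ d
    ≤⟨ +-mono-≤ IH IH ⟩
      cliques (segment (suc c) m) (⊆first d) + cliques (segment (suc c) m) (⊆first d)
    ≡⟨ cong₂ _+_ (cliques-tail-segment c m _) (cliques-tail-segment c m _) ⟩
      cliques G' (⊆first d) + cliques G' (⊆first d)
    ≤⟨ +-monoˡ-≤ _ (cliques-mono G' (λ S e → trans (cong (_∧ ⊆nbhd₀ G S) e) (⊆first⇒⊆nbhd₀ c m same S e))) ⟩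
      cliques G' (λ S → ⊆first (suc d) (true ∷ S) ∧ ⊆nbhd₀ G S) + cliques G' (λ S → ⊆first (suc d) (false ∷ S))
    ≡⟨ ≡-sym (cliques-∷ G (⊆first (suc d))) ⟩
      cliques G (⊆first (suc d)) ∎
    where
    open ≤-Reasoning
    G  = segment c (suc m)
    G' = tailGraph G
    IH : 2 ^ d ≤ cliques (segment (suc c) m) (⊆first d)
    IH = 2^d≤cliques-⊆first d (suc c) m d≤m (SameBlock-suc c same)

  -- The e vertices of the first block add 2^e - 1 nonempty cliques; the empty clique is counted on both sides.
  cliques-segment-split : ∀ e c m → SameBlock c e →
    2 ^ e + allCliques (segment (c + e) m) ≤ allCliques (segment c (e + m)) + 1
  cliques-segment-split zero c m _ =
    ≤-reflexive (trans (cong (λ x → 1 + allCliques (segment x m)) (+-identityʳ c)) (+-comm 1 _))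
  cliques-segment-split (suc e) c m same = begin
      2 ^ e + (2 ^ e + 0) + allCliques (segment (c + suc e) m)
    ≡⟨ cong₂ (λ x y → (2 ^ e + x) + allCliques (segment y m)) (+-identityʳ (2 ^ e)) (+-suc c e) ⟩
      (2 ^ e + 2 ^ e) + allCliques (segment (suc c + e) m)
    ≡⟨ +-assoc (2 ^ e) (2 ^ e) _ ⟩
      2 ^ e + (2 ^ e + allCliques (segment (suc c + e) m))
    ≤⟨ +-mono-≤ (2^d≤cliques-⊆first e (suc c) (e + m) (m≤m+n e m) (SameBlock-suc c same))
                (cliques-segment-split e (suc c) m (SameBlock-suc c same)) ⟩
      cliques (segment (suc c) (e + m)) (⊆first e) + (allCliques (segment (suc c) (e + m)) + 1)
    ≡⟨ ≡-sym (+-assoc (cliques (segment (suc c) (e + m)) (⊆first e)) _ 1) ⟩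
      (cliques (segment (suc c) (e + m)) (⊆first e) + allCliques (segment (suc c) (e + m))) + 1
    ≡⟨ cong (_+ 1) (cong₂ _+_ (cliques-tail-segment c (e + m) _) (cliques-tail-segment c (e + m) _)) ⟩
      (cliques G' (⊆first e) + allCliques G') + 1
    ≤⟨ +-monoˡ-≤ 1 (+-monoˡ-≤ (allCliques G') (cliques-mono G' (⊆first⇒⊆nbhd₀ c (e + m) same))) ⟩
      (cliques G' (λ S → true ∧ ⊆nbhd₀ G S) + cliques G' (λ _ → true)) + 1
    ≡⟨ cong (_+ 1) (≡-sym (cliques-∷ G (λ _ → true))) ⟩
      allCliques G + 1 ∎
    where
    open ≤-Reasoning
    G  = segment c (suc (e + m))
    G' = tailGraph G

  cliques-segment-blocks : ∀ a q b → b ≤ r →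
    a * 2 ^ suc r + 2 ^ b ≤ allCliques (segment (q * suc r) (a * suc r + b)) + a
  cliques-segment-blocks zero q b b≤r = +-cancelʳ-≤ 1 _ _ (begin
      2 ^ b + 1
    ≤⟨ cliques-segment-split b (q * suc r) 0 (SameBlock-block q (m≤n⇒m≤1+n b≤r)) ⟩
      allCliques (segment (q * suc r) (b + 0)) + 1
    ≡⟨ cong (λ x → allCliques (segment (q * suc r) x) + 1) (+-identityʳ b) ⟩
      allCliques (segment (q * suc r) b) + 1
    ≡⟨ cong (_+ 1) (≡-sym (+-identityʳ _)) ⟩
      allCliques (segment (q * suc r) b) + 0 + 1 ∎)
    where open ≤-Reasoning
  cliques-segment-blocks (suc a) q b b≤r = begin
      (2 ^ suc r + a * 2 ^ suc r) + 2 ^ b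
    ≡⟨ +-assoc (2 ^ suc r) _ _ ⟩
      2 ^ suc r + (a * 2 ^ suc r + 2 ^ b)
    ≤⟨ +-monoʳ-≤ (2 ^ suc r) (cliques-segment-blocks a (suc q) b b≤r) ⟩
      2 ^ suc r + (allCliques (segment (suc q * suc r) (a * suc r + b)) + a)
    ≡⟨ ≡-sym (+-assoc (2 ^ suc r) _ a) ⟩
      (2 ^ suc r + allCliques (segment (suc q * suc r) (a * suc r + b))) + a
    ≡⟨ cong (λ x → (2 ^ suc r + allCliques (segment x (a * suc r + b))) + a) (+-comm (suc r) (q * suc r)) ⟩
      (2 ^ suc r + allCliques (segment (q * suc r + suc r) (a * suc r + b))) + a
    ≤⟨ +-monoˡ-≤ a (cliques-segment-split (suc r) (q * suc r) (a * suc r + b) (SameBlock-block q ≤-refl)) ⟩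
      (allCliques (segment (q * suc r) (suc r + (a * suc r + b))) + 1) + a
    ≡⟨ +-assoc _ 1 a ⟩
      allCliques (segment (q * suc r) (suc r + (a * suc r + b))) + suc a
    ≡⟨ cong (λ x → allCliques (segment (q * suc r) x) + suc a) (≡-sym (+-assoc (suc r) (a * suc r) b)) ⟩
      allCliques (segment (q * suc r) (suc a * suc r + b)) + suc a ∎
    where open ≤-Reasoning

blockGraph-cliques : ∀ a r b → b ≤ r → a * 2 ^ suc r + 2 ^ b ≤ kTotal (blockGraph a r b) + a
blockGraph-cliques a r b b≤r =
  ≤-trans (cliques-segment-blocks r a 0 b b≤r) (+-monoˡ-≤ a (cliques≤kTotal (blockGraph a r b)))

-- Comparing the two counts

<-from-bounds : ∀ s {x y c d e a} → .{{ℕ.NonZero s}} →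
  s * x + c ≤ d → d + s * a < s * e + c → e ≤ y + a → x < y
<-from-bounds s {x} {y} {c} {d} {e} {a} sx+c≤d d+sa<se+c e≤y+a =
  *-cancelˡ-< s x y (+-cancelʳ-< (c + s * a) (s * x) (s * y) (begin-strict
    s * x + (c + s * a)   ≡⟨ ≡-sym (+-assoc (s * x) c (s * a)) ⟩
    (s * x + c) + s * a   ≤⟨ +-monoˡ-≤ (s * a) sx+c≤d ⟩
    d + s * a             <⟨ d+sa<se+c ⟩
    s * e + c             ≤⟨ +-monoˡ-≤ c (*-monoʳ-≤ s e≤y+a) ⟩
    s * (y + a) + c       ≡⟨ regroup s y a c ⟩
    s * y + (c + s * a)   ∎))
  where
  open ≤-Reasoning
  regroup : ∀ s y a c → s * (y + a) + c ≡ s * y + (c + s * a)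
  regroup = solve-∀

top-three : ∀ u b → u < b → b ≤ 3 + u → b ≡ 1 + u ⊎ b ≡ 2 + u ⊎ b ≡ 3 + u
top-three zero    1       _         _               = inj₁ refl
top-three zero    2       _         _               = inj₂ (inj₁ refl)
top-three zero    3       _         _               = inj₂ (inj₂ refl)
top-three zero    (suc (suc (suc (suc _)))) _ (s≤s (s≤s (s≤s ())))
top-three (suc u) (suc b) (s≤s u<b) (s≤s b≤3+u) with top-three u b u<b b≤3+u
... | inj₁ b≡1+u        = inj₁ (cong suc b≡1+u)
... | inj₂ (inj₁ b≡2+u) = inj₂ (inj₁ (cong suc b≡2+u))
... | inj₂ (inj₂ b≡3+u) = inj₂ (inj₂ (cong suc b≡3+u))

<-from-≡suc+ : ∀ {x y} z → y ≡ suc (x + z) → x < y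
<-from-≡suc+ {x} z refl = s≤s (m≤m+n x z)

-- b 2^r < (r - 1) 2^b + 2b + (r - 3) 2^r + 4 for r = 3 + u, in the three cases b = r - 2, r - 1, r.
gap-r-2 : ∀ u → (1 + u) * 2 ^ (3 + u) < (2 + u) * 2 ^ (1 + u) + 2 * (1 + u) + u * 2 ^ (3 + u) + 4
gap-r-2 zero          = ≤ᵇ⇒≤ _ _ _
gap-r-2 (suc zero)    = ≤ᵇ⇒≤ _ _ _
gap-r-2 (suc (suc v)) = <-from-≡suc+ _ (identity v (2 ^ (3 + v)))
  where
  identity : ∀ v y → (4 + v) * y + 2 * (3 + v) + (2 + v) * (2 * (2 * y)) + 4
                   ≡ suc ((3 + v) * (2 * (2 * y)) + (v * y + 2 * v + 9))
  identity = solve-∀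

gap-r-1 : ∀ u → ¬ u ≡ 0 → (2 + u) * 2 ^ (3 + u) < (2 + u) * 2 ^ (2 + u) + 2 * (2 + u) + u * 2 ^ (3 + u) + 4
gap-r-1 zero          u≢0 = contradiction refl u≢0
gap-r-1 (suc zero)    _   = ≤ᵇ⇒≤ _ _ _
gap-r-1 (suc (suc v)) _   = <-from-≡suc+ _ (identity v (2 ^ (4 + v)))
  where
  identity : ∀ v y → (4 + v) * y + 2 * (4 + v) + (2 + v) * (2 * y) + 4
                   ≡ suc ((4 + v) * (2 * y) + (v * y + 2 * v + 11))
  identity = solve-∀

gap-r : ∀ u → (3 + u) * 2 ^ (3 + u) < (2 + u) * 2 ^ (3 + u) + 2 * (3 + u) + u * 2 ^ (3 + u) + 4
gap-r zero    = ≤ᵇ⇒≤ _ _ _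
gap-r (suc v) = <-from-≡suc+ _ (identity v (2 ^ (4 + v)))
  where
  identity : ∀ v y → (3 + v) * y + 2 * (4 + v) + (1 + v) * y + 4 ≡ suc ((4 + v) * y + (v * y + 2 * v + 11))
  identity = solve-∀

power-gap : ∀ u b → b ≤ 3 + u → ¬ (u ≡ 0 × b ≡ 2) →
  b * 2 ^ (3 + u) < (2 + u) * 2 ^ b + 2 * b + u * 2 ^ (3 + u) + 4
power-gap u b b≤3+u ¬exceptional with b ≤? u
... | yes b≤u =
  ≤-<-trans (*-monoˡ-≤ (2 ^ (3 + u)) b≤u)
            (≤-<-trans (m≤n+m (u * 2 ^ (3 + u)) ((2 + u) * 2 ^ b + 2 * b)) (m<m+n _ (s≤s z≤n)))
... | no  b≰u with top-three u b (≰⇒> b≰u) b≤3+u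
...   | inj₁ refl        = gap-r-2 u
...   | inj₂ (inj₁ refl) = gap-r-1 u (λ u≡0 → ¬exceptional (u≡0 , cong (λ x → 2 + x) u≡0))
...   | inj₂ (inj₂ refl) = gap-r u

block-gap-generic : ∀ u a b → 1 ≤ a → b ≤ 3 + u → ¬ (u ≡ 0 × b ≡ 2) →
  (2 + u) + b * 2 ^ (3 + u) < (2 + u) * 2 ^ b + 2 * b + a * (u * 2 ^ (3 + u) + u + 6)
block-gap-generic u a b 1≤a b≤3+u ¬exceptional = begin-strict
    (2 + u) + b * P
  <⟨ +-monoʳ-< (2 + u) (power-gap u b b≤3+u ¬exceptional) ⟩
    (2 + u) + ((2 + u) * 2 ^ b + 2 * b + u * P + 4)
  ≡⟨ regroup u (2 ^ b) b P ⟩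
    (2 + u) * 2 ^ b + 2 * b + (u * P + u + 6)
  ≤⟨ +-monoʳ-≤ ((2 + u) * 2 ^ b + 2 * b) (m≤n*m (u * P + u + 6) a {{ℕ.>-nonZero 1≤a}}) ⟩
    (2 + u) * 2 ^ b + 2 * b + a * (u * P + u + 6) ∎
  where
  open ≤-Reasoning
  P = 2 ^ (3 + u)
  regroup : ∀ u x b P → (2 + u) + ((2 + u) * x + 2 * b + u * P + 4) ≡ (2 + u) * x + 2 * b + (u * P + u + 6)
  regroup = solve-∀

-- At r = 3, b = 2 the bounds only separate for a ≥ 2; for a = 1 both give 19.
block-gap-core : ∀ u a b → 1 ≤ a → b ≤ 3 + u → ¬ (u ≡ 0 × b ≡ 2 × a ≡ 1) →
  (2 + u) + b * 2 ^ (3 + u) < (2 + u) * 2 ^ b + 2 * b + a * (u * 2 ^ (3 + u) + u + 6)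
block-gap-core u a b 1≤a b≤3+u ¬exceptional with u ℕ.≟ 0 | b ℕ.≟ 2
... | no u≢0    | _         = block-gap-generic u a b 1≤a b≤3+u (λ (u≡0 , _) → u≢0 u≡0)
... | yes _     | no b≢2    = block-gap-generic u a b 1≤a b≤3+u (λ (_ , b≡2) → b≢2 b≡2)
... | yes refl  | yes refl  with a
...   | 1           = contradiction (refl , refl , refl) ¬exceptional
...   | suc (suc a) = <-from-≡suc+ (6 * a + 5) (identity a)
  where
  identity : ∀ a → 2 * 4 + 2 * 2 + (2 + a) * (0 * 8 + 0 + 6) ≡ suc (18 + (6 * a + 5))
  identity = solve-∀

-- The middle hypothesis of <-from-bounds for kTotal-bound and blockGraph-cliques,
-- at r = 3 + u and n = a (r + 1) + b.
block-gap : ∀ u a b → 1 ≤ a → b ≤ 3 + u → ¬ (u ≡ 0 × b ≡ 2 × a ≡ 1) →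
  (2 + u) * suc (a * (4 + u) + b) + (a * (4 + u) + b) * 2 ^ (3 + u) + (2 + u) * a
    < (2 + u) * (a * 2 ^ (4 + u) + 2 ^ b) + (a * (4 + u) + b) * (4 + u)
block-gap u a b 1≤a b≤3+u ¬exceptional =
  subst₂ _<_ (≡-sym (expand-left u a b (2 ^ (3 + u)))) (≡-sym (expand-right u a b (2 ^ (3 + u)) (2 ^ b)))
         (+-monoˡ-< common (block-gap-core u a b 1≤a b≤3+u ¬exceptional))
  where
  common = (2 + u) * b + a * ((2 + u) * (4 + u) + (4 + u) * 2 ^ (3 + u) + (2 + u))
  expand-left : ∀ u a b P →
    (2 + u) * suc (a * (4 + u) + b) + (a * (4 + u) + b) * P + (2 + u) * a
      ≡ ((2 + u) + b * P) + ((2 + u) * b + a * ((2 + u) * (4 + u) + (4 + u) * P + (2 + u)))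
  expand-left = solve-∀
  expand-right : ∀ u a b P x →
    (2 + u) * (a * (2 * P) + x) + (a * (4 + u) + b) * (4 + u)
      ≡ ((2 + u) * x + 2 * b + a * (u * P + u + 6)) + ((2 + u) * b + a * ((2 + u) * (4 + u) + (4 + u) * P + (2 + u)))
  expand-right = solve-∀

kTotal<blockGraph : ∀ u a b (G : Graph (a * (4 + u) + b)) → 1 ≤ a → b ≤ 3 + u → ¬ (u ≡ 0 × b ≡ 2 × a ≡ 1) →
  MaxDegree≤ G (3 + u) → CliqueRatio (3 + u) G → kTotal G < kTotal (blockGraph a (3 + u) b)
kTotal<blockGraph u a b G 1≤a b≤3+u ¬exceptional Δ≤r ratio =
  <-from-bounds (2 + u) (kTotal-bound (3 + u) G Δ≤r ratio) (block-gap u a b 1≤a b≤3+u ¬exceptional)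
                (blockGraph-cliques a (3 + u) b b≤3+u)

-- Exhaustive search over graphs

-- A graph on n vertices, stored as the adjacencies of each vertex to the later ones.
UpperTriangle : ℕ → Set
UpperTriangle zero    = ⊤
UpperTriangle (suc n) = Vec Bool n × UpperTriangle n

triangleAdj : ∀ {n} → UpperTriangle n → Fin n → Fin n → Bool
triangleAdj (_ , _)      zero    zero    = false
triangleAdj (row , _)    zero    (suc j) = lookup row j
triangleAdj (row , _)    (suc i) zero    = lookup row i
triangleAdj (_ , lower)  (suc i) (suc j) = triangleAdj lower i j

triangleAdj-sym : ∀ {n} (T : UpperTriangle n) i j → triangleAdj T i j ≡ triangleAdj T j i
triangleAdj-sym _             zero    zero    = refl
triangleAdj-sym (row , _)     zero    (suc j) = refl
triangleAdj-sym (row , _)     (suc i) zero    = refl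
triangleAdj-sym (_ , lower)   (suc i) (suc j) = triangleAdj-sym lower i j

triangleAdj-irrefl : ∀ {n} (T : UpperTriangle n) i → triangleAdj T i i ≡ false
triangleAdj-irrefl (_ , _)     zero    = refl
triangleAdj-irrefl (_ , lower) (suc i) = triangleAdj-irrefl lower i

fromTriangle : ∀ {n} → UpperTriangle n → Graph n
fromTriangle T = record { adj = triangleAdj T ; sym = triangleAdj-sym T ; irrefl = triangleAdj-irrefl T }

toTriangle : ∀ {n} → Graph n → UpperTriangle n
toTriangle {zero}  G = tt
toTriangle {suc n} G = Vec.tabulate (adj G zero ∘ suc) , toTriangle (tailGraph G)

fromTriangle-toTriangle : ∀ {n} (G : Graph n) → fromTriangle (toTriangle G) ≈ᴳ G
fromTriangle-toTriangle G zero    zero    = ≡-sym (irrefl G zero)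
fromTriangle-toTriangle G zero    (suc j) = lookup∘tabulate (adj G zero ∘ suc) j
fromTriangle-toTriangle G (suc i) zero    = trans (lookup∘tabulate (adj G zero ∘ suc) i) (Graph.sym G zero (suc i))
fromTriangle-toTriangle G (suc i) (suc j) = fromTriangle-toTriangle (tailGraph G) i j

allVecs? : ∀ m → (Vec Bool m → Bool) → Bool
allVecs? zero    p = p []
allVecs? (suc m) p = allVecs? m (p ∘ (true ∷_)) ∧ allVecs? m (p ∘ (false ∷_))

allVecs?-sound : ∀ m (p : Vec Bool m → Bool) → allVecs? m p ≡ true → ∀ v → p v ≡ true
allVecs?-sound zero    p all≡true [] = all≡true
allVecs?-sound (suc m) p all≡true (b ∷ v) with allVecs? m (p ∘ (true ∷_)) in eq | b
... | true  | true  = allVecs?-sound m (p ∘ (true ∷_)) eq v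
... | true  | false = allVecs?-sound m (p ∘ (false ∷_)) all≡true v

allTriangles? : ∀ n → (UpperTriangle n → Bool) → Bool
allTriangles? zero    p = p tt
allTriangles? (suc n) p = allVecs? n (λ row → allTriangles? n (λ lower → p (row , lower)))

allTriangles?-sound : ∀ n (p : UpperTriangle n → Bool) → allTriangles? n p ≡ true → ∀ T → p T ≡ true
allTriangles?-sound zero    p all≡true tt            = all≡true
allTriangles?-sound (suc n) p all≡true (row , lower) =
  allTriangles?-sound n (λ lower → p (row , lower)) (allVecs?-sound n _ all≡true row) lower

allGraphs? : ∀ n → (Graph n → Bool) → Bool
allGraphs? n p = allTriangles? n (p ∘ fromTriangle)

allGraphs?-sound : ∀ n (p : Graph n → Bool) → (∀ G H → G ≈ᴳ H → p G ≡ p H) →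
  allGraphs? n p ≡ true → ∀ G → p G ≡ true
allGraphs?-sound n p p-cong all≡true G =
  trans (≡-sym (p-cong _ G (fromTriangle-toTriangle G))) (allTriangles?-sound n (p ∘ fromTriangle) all≡true (toTriangle G))

cubic⇒k₃≤2? : Graph 6 → Bool
cubic⇒k₃≤2? G =
  if (18 ≤ᵇ sumDegrees G) ∧ andF (λ v → degree G v ≤ᵇ 3)
  then k_ G 3 ≤ᵇ 2
  else true

-- K₃,₃ and the prism are the only cubic graphs on six vertices.
cubic⇒k₃≤2?-all : allGraphs? 6 cubic⇒k₃≤2? ≡ true
cubic⇒k₃≤2?-all = refl

cubic⇒k₃≤2?-cong : ∀ (G H : Graph 6) → G ≈ᴳ H → cubic⇒k₃≤2? G ≡ cubic⇒k₃≤2? H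
cubic⇒k₃≤2?-cong G H G≈H
  rewrite k-cong G H G≈H 3
        | sumF-cong (degree-cong G H G≈H)
        | andF-cong (λ v → cong (_≤ᵇ 3) (degree-cong G H G≈H v)) = refl

cubic⇒k₃≤2 : ∀ (G : Graph 6) → MaxDegree≤ G 3 → 18 ≤ sumDegrees G → k_ G 3 ≤ 2
cubic⇒k₃≤2 G Δ≤3 18≤∑deg = ≤ᵇ⇒≤ _ _ (Equivalence.from T-≡ conclusion)
  where
  holds : ∀ {m n} → m ≤ n → (m ≤ᵇ n) ≡ true
  holds = Equivalence.to T-≡ ∘ ≤⇒≤ᵇ
  cubic : ((18 ≤ᵇ sumDegrees G) ∧ andF (λ v → degree G v ≤ᵇ 3)) ≡ true
  cubic = cong₂ _∧_ (holds 18≤∑deg) (andF-true (holds ∘ Δ≤3))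
  conclusion : (k_ G 3 ≤ᵇ 2) ≡ true
  conclusion = trans (cong (λ h → if h then k_ G 3 ≤ᵇ 2 else true) (≡-sym cubic))
                     (allGraphs?-sound 6 cubic⇒k₃≤2? cubic⇒k₃≤2?-cong cubic⇒k₃≤2?-all G)

kTotal≤18 : ∀ (G : Graph 6) → MaxDegree≤ G 3 → CliqueRatio 3 G → kTotal G ≤ 18
kTotal≤18 G Δ≤3 ratio = begin
    kTotal G
  ≡⟨ kTotal≡∑ G ⟩
    k_ G 0 + (k_ G 1 + (k_ G 2 + (k_ G 3 + (k_ G 4 + (k_ G 5 + (k_ G 6 + 0))))))
  ≡⟨ cong (λ x → k_ G 0 + (k_ G 1 + (k_ G 2 + (k_ G 3 + x)))) no-K₄ ⟩
    k_ G 0 + (k_ G 1 + (k_ G 2 + (k_ G 3 + 0)))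
  ≤⟨ +-mono-≤ (k₀≤1 G) (+-mono-≤ (k₁≤n G) (+-mono-≤ k₂≤9 (+-mono-≤ k₃≤2 z≤n))) ⟩
    18 ∎
  where
  open ≤-Reasoning
  ratio′ : ∀ t → 2 ≤ t → suc t * k_ G (suc t) ≤ (3 ∸ t) * k_ G t
  ratio′ = ratioℤ⇒ratioℕ 3 (k_ G) ratio
  vanishing : ∀ t → 3 ≤ t → k_ G (suc t) ≡ 0
  vanishing t 3≤t = ratio⇒vanishing 3 (k_ G) ratio′ t (≤-trans (n≤1+n 2) 3≤t) 3≤t
  no-K₄ : k_ G 4 + (k_ G 5 + (k_ G 6 + 0)) ≡ 0
  no-K₄ rewrite vanishing 3 ≤-refl | vanishing 4 (n≤1+n 3) | vanishing 5 (m≤n+m 3 2) = refl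
  k₂≤9 : k_ G 2 ≤ 9
  k₂≤9 = *-cancelˡ-≤ 2 (subst (_≤ 18) (cong (λ x → k_ G 2 + x) (≡-sym (+-identityʳ (k_ G 2)))) (2k₂≤nΔ G 3 Δ≤3))
  3k₃≤k₂ : 3 * k_ G 3 ≤ k_ G 2
  3k₃≤k₂ = ≤-trans (ratio′ 2 ≤-refl) (≤-reflexive (+-identityʳ (k_ G 2)))
  k₃≤2 : k_ G 3 ≤ 2
  k₃≤2 with k_ G 2 ≤? 8
  ... | yes k₂≤8 = ≤-pred (*-cancelˡ-< 3 (k_ G 3) 3 (≤-<-trans 3k₃≤k₂ (s≤s k₂≤8)))
  ... | no  k₂≰8 = cubic⇒k₃≤2 G Δ≤3 (≤-trans (+-mono-≤ (≰⇒> k₂≰8) (≰⇒> k₂≰8)) (handshake G))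

corollary5p3 : (r : ℕ) → 3 ≤ r → (n : ℕ) → (G : Graph n) → MaxDegree≤ G r
    → (∀ (t : ℕ) → 3 ≤ t → (+ t) *ℤ (+ k_ G t) ≤ℤ ((+ (r + 1)) - (+ t)) *ℤ (+ k_ G (t ∸ 1)))
    → (a b : ℕ) → 1 ≤ a → b ≤ r → n ≡ a * suc r + b
    → kTotal G < kTotal (blockGraph a r b)
corollary5p3 (suc (suc (suc u))) (s≤s (s≤s (s≤s z≤n))) _ G Δ≤r ratio a b 1≤a b≤r refl
  with (u ℕ.≟ 0) ×-dec (b ℕ.≟ 2) ×-dec (a ℕ.≟ 1)
... | yes (refl , refl , refl) =
  <-≤-trans (s≤s (kTotal≤18 G Δ≤r ratio)) (+-cancelʳ-≤ 1 19 _ (blockGraph-cliques 1 3 2 (s≤s (s≤s z≤n))))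
... | no ¬exceptional = kTotal<blockGraph u a b G 1≤a b≤r ¬exceptional Δ≤r ratio
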